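{- Let $x\in\{0,1\}^n$ (up to rotation) have more 1's than 0's and at least two unmatched 1's, and let $w$ be its Lyndon rearrangement. Let $\phi(x)$ be represented by the word $w'$ obtained from $w$ by changing the rightmost unmatched 1 into a 0. Then the parenthesization pairs of $w'$ are exactly those of $w$ (same positions), together with one additional pair. This new pair consists of the letter changed from 1 to 0 and the leftmost unmatched 1 of $w$.
   Context: Lyndon rearrangement: order letters by $1\prec 0$; the Lyndon rearrangement of a word is its lexicographically smallest cyclic rotation. Parenthesization: regard the word cyclically; repeatedly take a 0 that is immediately followed cyclically (among not yet matched letters) by a 1, match these two letters as a parenthesization pair, and remove them, until no such 0 remains. The resulting matching does not depend on choices. For a word with more 1's than 0's, the unmatched letters are all 1's. For $x$ with more 1's than 0's, $\phi(x)$ is the class of the word obtained from the Lyndon rearrangement of $x$ by changing its rightmost unmatched 1 into a 0. -}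

module Defs where

open import Data.Nat using (ℕ; zero; suc; _<_)
open import Data.List using (List; []; _∷_; _++_; drop; take; length; reverse; zip; upTo)
open import Data.Maybe using (Maybe; just; nothing)
open import Data.Product using (_×_; _,_; Σ; ∃)
open import Data.Sum using (_⊎_)
open import Relation.Nullary using (¬_)
open import Relation.Binary.PropositionalEquality using (_≡_)
open import Data.List.Membership.Propositional using (_∈_)

data Bit : Set where
  b0 b1 : Bit

Word : Set
Word = List Bit

count : Bit → Word → ℕ
count a [] = 0
count b0 (b0 ∷ w) = suc (count b0 w)
count b0 (b1 ∷ w) = count b0 w
count b1 (b1 ∷ w) = suc (count b1 w)
count b1 (b0 ∷ w) = count b1 w

at : Word → ℕ → Maybe Bit
at [] _ = nothing
at (a ∷ w) zero = just a
at (a ∷ w) (suc i) = at w i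

setAt : ℕ → Bit → Word → Word
setAt _ _ [] = []
setAt zero b (a ∷ w) = b ∷ w
setAt (suc i) b (a ∷ w) = a ∷ setAt i b w

rotate : ℕ → Word → Word
rotate k w = drop k w ++ take k w

-- lexicographic order with 1 ≺ 0 (non-strict); used on words of equal length
data _≤L_ : Word → Word → Set where
  []≤   : ∀ {ys} → [] ≤L ys
  10≤   : ∀ {xs ys} → (b1 ∷ xs) ≤L (b0 ∷ ys)
  cons≤ : ∀ {a xs ys} → xs ≤L ys → (a ∷ xs) ≤L (a ∷ ys)

IsLyndonRearrangement : Word → Word → Set
IsLyndonRearrangement x w =
  (∃ λ k → w ≡ rotate k x) × (∀ k → w ≤L rotate k x)

-- The not-yet-matched letters are kept as a list of
-- (original position , letter) in cyclic order.  One step of the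
-- procedure matches a 0 with the 1 immediately following it cyclically
-- among the remaining letters (we choose the first such 0 in reading
-- order among adjacent pairs, else the wrap-around pair last/first;
-- the result does not depend on choices).  A pair is recorded as
-- (position of the 0 , position of the 1).

Letters : Set
Letters = List (ℕ × Bit)

adjStep : Letters → Maybe ((ℕ × ℕ) × Letters)
adjStep [] = nothing
adjStep (_ ∷ []) = nothing
adjStep ((i , b0) ∷ (j , b1) ∷ rest) = just ((i , j) , rest)
adjStep (x ∷ y ∷ rest) with adjStep (y ∷ rest)
... | nothing = nothing
... | just (p , l) = just (p , x ∷ l)

wrapStep : Letters → Maybe ((ℕ × ℕ) × Letters)
wrapStep ((j , b1) ∷ rest) with reverse rest
... | (i , b0) ∷ rrest = just ((i , j) , reverse rrest)
... | _ = nothing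
wrapStep _ = nothing

step : Letters → Maybe ((ℕ × ℕ) × Letters)
step l with adjStep l
... | just r = just r
... | nothing = wrapStep l

matchFuel : ℕ → Letters → List (ℕ × ℕ)
matchFuel zero _ = []
matchFuel (suc f) l with step l
... | nothing = []
... | just (p , l') = p ∷ matchFuel f l'

-- the parenthesization pairs of a word (each step removes two letters,
-- so length w steps suffice)
pairs : Word → List (ℕ × ℕ)
pairs w = matchFuel (length w) (zip (upTo (length w)) w)

Unmatched : Word → ℕ → Set
Unmatched w i =
  (i < length w) × (at w i ≡ just b1) ×
  ¬ (Σ ℕ λ j → ((i , j) ∈ pairs w) ⊎ ((j , i) ∈ pairs w))

RightmostUnmatched : Word → ℕ → Set
RightmostUnmatched w r = Unmatched w r × (∀ j → Unmatched w j → j Data.Nat.≤ r)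

LeftmostUnmatched : Word → ℕ → Set
LeftmostUnmatched w l = Unmatched w l × (∀ j → Unmatched w j → l Data.Nat.≤ j)

-- Parenthesization is a rewriting system on the list of not yet matched letters,
-- numbered by position, whose steps are locally confluent; hence every maximal run
-- matches exactly the pairs `pairs w`. On w such a run leaves the unmatched 1's, in
-- increasing position from l to r, and none of its steps touches r. So the same run is
-- valid on w with r relabelled 0 and leaves 1…1 0, beginning with l and ending with r;
-- the wrap-around step then matches r with l, and only 1's remain. The number of
-- unmatched 1's is #1 − #0, which rotation preserves, so w inherits two of them from x.

module Submission where

open import Defs
open import Data.Nat using (ℕ; zero; suc; _+_; _<_; _≤_; z≤n; s≤s; s≤s⁻¹; z<s; _≟_)
open import Data.Nat.Properties
  using (≤-refl; ≤-reflexive; ≤-trans; <⇒≤; <⇒≢; ≤-antisym; n≤1+n; m<m+n;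
         +-comm; +-suc; +-identityʳ; +-cancelʳ-≡; +-cancelʳ-<)
open import Data.List
  using (List; []; _∷_; _++_; _∷ʳ_; [_]; length; map; reverse; zip; applyUpTo; take; drop; initLast; _∷ʳ′_)
open import Data.List.Properties
  using (∷-injective; ∷ʳ-injective; ++-identityʳ; ++-assoc; length-++; map-++;
         reverse-++; reverse-involutive; take++drop≡id)
open import Data.List.Membership.Propositional using (_∈_)
open import Data.List.Membership.Propositional.Properties using (∈-++⁺ˡ; ∈-++⁺ʳ; ∈-++⁻)
open import Data.List.Relation.Unary.Any using (here; there)
open import Data.List.Relation.Unary.All as All using (All; []; _∷_)
open import Data.List.Relation.Unary.All.Properties using (∷ʳ⁻)
open import Data.List.Relation.Unary.AllPairs using (AllPairs; []; _∷_)
open import Data.List.Relation.Unary.Any.Properties using (∷↔)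
open import Data.Maybe using (just; nothing)
open import Data.Product using (_×_; _,_; Σ; proj₁; proj₂)
open import Data.Sum using (_⊎_; inj₁; inj₂; [_,_]′; map₂)
open import Data.Sum.Function.Propositional using (_⊎-⇔_)
open import Data.Empty using (⊥-elim)
open import Function using (_∘_)
open import Function.Bundles using (_⇔_; mk⇔)
import Function.Properties.Equivalence as ⇔
open import Function.Properties.Inverse using (↔⇒⇔)
open import Level using (0ℓ)
open import Relation.Nullary using (¬_; yes; no)
open import Relation.Binary.PropositionalEquality
  using (_≡_; _≢_; ≢-sym; refl; sym; trans; cong; cong₂; subst; subst₂; module ≡-Reasoning)

∈-∷ : ∀ {A : Set} {p x : A} {xs} → (p ∈ x ∷ xs) ⇔ (p ≡ x ⊎ p ∈ xs)
∈-∷ = ⇔.sym (↔⇒⇔ (∷↔ _))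

∈-∷ʳ : ∀ {A : Set} {p x : A} xs → (p ∈ xs ∷ʳ x) ⇔ (p ∈ xs ⊎ p ≡ x)
∈-∷ʳ xs = mk⇔ (map₂ (λ { (here p≡x) → p≡x ; (there ()) }) ∘ ∈-++⁻ xs)
              [ ∈-++⁺ˡ , ∈-++⁺ʳ xs ∘ here ]′

⊎-exchange : ∀ {A B C : Set} → (A ⊎ (B ⊎ C)) ⇔ (B ⊎ (A ⊎ C))
⊎-exchange = mk⇔ exchange exchange
  where
  exchange : ∀ {A B C : Set} → A ⊎ (B ⊎ C) → B ⊎ (A ⊎ C)
  exchange = [ inj₂ ∘ inj₁ , [ inj₁ , inj₂ ∘ inj₂ ]′ ]′

allPairs-∷ʳ⁻ : ∀ {A : Set} {R : A → A → Set} xs {x} → AllPairs R (xs ∷ʳ x)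
             → AllPairs R xs × All (λ y → R y x) xs
allPairs-∷ʳ⁻ [] _ = [] , []
allPairs-∷ʳ⁻ (y ∷ xs) (Ry ∷ Rxs) with ∷ʳ⁻ {xs = xs} Ry | allPairs-∷ʳ⁻ xs Rxs
... | Ry′ , Ryx | Rxs′ , Rxsx = (Ry′ ∷ Rxs′) , (Ryx ∷ Rxsx)

first-middle-last : ∀ {A : Set} {L : List A} → 2 ≤ length L → Σ A λ x → Σ (List A) λ C → Σ A λ y → L ≡ x ∷ C ∷ʳ y
first-middle-last {L = x ∷ L} (s≤s 1≤) with initLast L
first-middle-last {L = x ∷ .(C ∷ʳ y)} _ | C ∷ʳ′ y = x , C , y , refl

two≤length : ∀ {A : Set} {x y : A} {L} → x ∈ L → y ∈ L → x ≢ y → 2 ≤ length L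
two≤length (here refl) (here refl) x≢y = ⊥-elim (x≢y refl)
two≤length (here _) (there {xs = _ ∷ _} _) _ = s≤s (s≤s z≤n)
two≤length (there {xs = _ ∷ _} _) _ _ = s≤s (s≤s z≤n)

count-++ : ∀ b (u v : Word) → count b (u ++ v) ≡ count b u + count b v
count-++ b  []       v = refl
count-++ b0 (b0 ∷ u) v = cong suc (count-++ b0 u v)
count-++ b0 (b1 ∷ u) v = count-++ b0 u v
count-++ b1 (b1 ∷ u) v = cong suc (count-++ b1 u v)
count-++ b1 (b0 ∷ u) v = count-++ b1 u v

count-rotate : ∀ b k x → count b (rotate k x) ≡ count b x
count-rotate b k x = begin
  count b (drop k x ++ take k x)           ≡⟨ count-++ b (drop k x) (take k x) ⟩
  count b (drop k x) + count b (take k x)  ≡⟨ +-comm (count b (drop k x)) _ ⟩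
  count b (take k x) + count b (drop k x)  ≡⟨ count-++ b (take k x) (drop k x) ⟨
  count b (take k x ++ drop k x)           ≡⟨ cong (count b) (take++drop≡id k x) ⟩
  count b x                                ∎
  where open ≡-Reasoning

-- Steps of the parenthesization and their local confluence

data Adjacent : Letters → ℕ × ℕ → Letters → Set where
  here  : ∀ {i j L} → Adjacent ((i , b0) ∷ (j , b1) ∷ L) (i , j) L
  there : ∀ {x L q L′} → Adjacent L q L′ → Adjacent (x ∷ L) q (x ∷ L′)

-- The wrap-around case is stated with an equation so that two of them can be compared.
data Step : Letters → ℕ × ℕ → Letters → Set where
  adjacent   : ∀ {L q L′} → Adjacent L q L′ → Step L q L′
  wraparound : ∀ {L i j C} → L ≡ (j , b1) ∷ C ∷ʳ (i , b0) → Step L (i , j) C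

adjStep-sound : ∀ L {q L′} → adjStep L ≡ just (q , L′) → Adjacent L q L′
adjStep-sound ((i , b0) ∷ (j , b1) ∷ L) refl = here
adjStep-sound ((i , b0) ∷ y@(j , b0) ∷ L) eq with adjStep (y ∷ L) in eq′
adjStep-sound ((i , b0) ∷ y@(j , b0) ∷ L) refl | just _ = there (adjStep-sound (y ∷ L) eq′)
adjStep-sound ((i , b1) ∷ y ∷ L) eq with adjStep (y ∷ L) in eq′
adjStep-sound ((i , b1) ∷ y ∷ L) refl | just _ = there (adjStep-sound (y ∷ L) eq′)

adjStep-complete : ∀ {L q L′} → Adjacent L q L′ → adjStep L ≢ nothing
adjStep-complete here ()
adjStep-complete (there {x = i , b0} {(j , b0) ∷ L} a) eq with adjStep ((j , b0) ∷ L) in eq′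
... | nothing = adjStep-complete a eq′
adjStep-complete (there {x = i , b1} {y ∷ L} a) eq with adjStep (y ∷ L) in eq′
... | nothing = adjStep-complete a eq′

wrapStep-∷ʳ : ∀ j C i → wrapStep ((j , b1) ∷ C ∷ʳ (i , b0)) ≡ just ((i , j) , C)
wrapStep-∷ʳ j C i rewrite reverse-++ C [ (i , b0) ] | reverse-involutive C = refl

wrapStep-sound : ∀ L {q L′} → wrapStep L ≡ just (q , L′) → Step L q L′
wrapStep-sound ((j , b1) ∷ L) eq with reverse L in eq′
wrapStep-sound ((j , b1) ∷ L) refl | (i , b0) ∷ C = wraparound (cong ((j , b1) ∷_) L≡)
  where
  L≡ : L ≡ reverse C ∷ʳ (i , b0)
  L≡ = begin
    L                             ≡⟨ reverse-involutive L ⟨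
    reverse (reverse L)           ≡⟨ cong reverse eq′ ⟩
    reverse ((i , b0) ∷ C)        ≡⟨ reverse-++ [ (i , b0) ] C ⟩
    reverse C ∷ʳ (i , b0)         ∎
    where open ≡-Reasoning

step-sound : ∀ L {q L′} → step L ≡ just (q , L′) → Step L q L′
step-sound L eq with adjStep L in eq′
step-sound L refl | just _ = adjacent (adjStep-sound L eq′)
step-sound L eq   | nothing = wrapStep-sound L eq

step-complete : ∀ {L q L′} → Step L q L′ → step L ≢ nothing
step-complete {L} s eq with adjStep L in eq′
step-complete (adjacent a) eq | nothing = adjStep-complete a eq′
step-complete (wraparound {i = i} {j} {C} refl) eq | nothing with () ← trans (sym (wrapStep-∷ʳ j C i)) eq

step-length : ∀ {L q L′} → Step L q L′ → length L ≡ 2 + length L′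
step-length (adjacent here) = refl
step-length (adjacent (there a)) = cong suc (step-length (adjacent a))
step-length (wraparound {C = C} refl) = cong suc (trans (length-++ C) (+-comm (length C) 1))

step-length-≤ : ∀ {L q L′ f} → Step L q L′ → length L ≤ suc f → length L′ ≤ f
step-length-≤ s L≤1+f rewrite step-length s = ≤-trans (n≤1+n _) (s≤s⁻¹ L≤1+f)

step-length≰0 : ∀ {L q L′} → Step L q L′ → ¬ length L ≤ 0
step-length≰0 s rewrite step-length s = λ ()

data Joinable (a : ℕ × ℕ) (La : Letters) (b : ℕ × ℕ) (Lb : Letters) : Set where
  same : a ≡ b → La ≡ Lb → Joinable a La b Lb
  join : ∀ {M} → Step La b M → Step Lb a M → Joinable a La b Lb

adjacent-∷ʳ : ∀ C {x a M} → proj₂ x ≡ b0 → Adjacent (C ∷ʳ x) a M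
            → Σ Letters λ C′ → Adjacent C a C′ × M ≡ C′ ∷ʳ x
adjacent-∷ʳ [] x≡b0 (there ())
adjacent-∷ʳ (y ∷ z ∷ C) x≡b0 here = C , here , refl
adjacent-∷ʳ (y ∷ [])    refl (there (there ()))
adjacent-∷ʳ (y ∷ C@(_ ∷ _)) x≡b0 (there a) with adjacent-∷ʳ C x≡b0 a
... | C′ , a′ , refl = y ∷ C′ , there a′ , refl

adjacent-diamond : ∀ {L a La b Lb} → Adjacent L a La → Adjacent L b Lb
                 → (a ≡ b × La ≡ Lb) ⊎ Σ Letters (λ M → Adjacent La b M × Adjacent Lb a M)
adjacent-diamond here here = inj₁ (refl , refl)
adjacent-diamond here (there (there s)) = inj₂ (_ , s , here)
adjacent-diamond (there (there s)) here = inj₂ (_ , here , s)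
adjacent-diamond (there s) (there t) with adjacent-diamond s t
... | inj₁ (refl , refl) = inj₁ (refl , refl)
... | inj₂ (M , u , v) = inj₂ (_ ∷ M , there u , there v)

step-diamond : ∀ {L a La b Lb} → Step L a La → Step L b Lb → Joinable a La b Lb
step-diamond (adjacent s) (adjacent t) with adjacent-diamond s t
... | inj₁ (a≡b , La≡Lb) = same a≡b La≡Lb
... | inj₂ (M , u , v) = join (adjacent u) (adjacent v)
step-diamond (adjacent (there s)) (wraparound {C = C} refl) with adjacent-∷ʳ C refl s
... | C′ , s′ , refl = join (wraparound refl) (adjacent s′)
step-diamond (wraparound {C = C} refl) (adjacent (there s)) with adjacent-∷ʳ C refl s
... | C′ , s′ , refl = join (adjacent s′) (wraparound refl)
step-diamond (wraparound {C = C} refl) (wraparound {C = C′} eq)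
  with refl , C∷ʳi≡C′∷ʳi′ ← ∷-injective eq with refl , refl ← ∷ʳ-injective C C′ C∷ʳi≡C′∷ʳi′ = same refl refl

data Run : Letters → List (ℕ × ℕ) → Letters → Set where
  done : ∀ {L} → Run L [] L
  more : ∀ {L q L′ Q R} → Step L q L′ → Run L′ Q R → Run L (q ∷ Q) R

Terminal : Letters → Set
Terminal R = ∀ {q R′} → ¬ Step R q R′

[]-terminal : Terminal []
[]-terminal (adjacent ())
[]-terminal (wraparound ())

run-++ : ∀ {L Q M Q′ R} → Run L Q M → Run M Q′ R → Run L (Q ++ Q′) R
run-++ done r = r
run-++ (more s r) r′ = more s (run-++ r r′)

matchFuel-terminal-run : ∀ f L → length L ≤ f → Σ Letters λ R → Run L (matchFuel f L) R × Terminal R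
matchFuel-terminal-run zero [] _ = [] , done , []-terminal
matchFuel-terminal-run (suc f) L L≤1+f with step L in eq
... | nothing = L , done , λ s → step-complete s eq
... | just (q , L′) with matchFuel-terminal-run f L′ (step-length-≤ (step-sound L eq) L≤1+f)
... | R , r , t = R , more (step-sound L eq) r , t

-- The step chosen by `step` and the given one are joined by the diamond property.
matchFuel-step : ∀ f {L q L′} → length L ≤ suc f → Step L q L′ → ∀ p
               → (p ∈ matchFuel (suc f) L) ⇔ (p ≡ q ⊎ p ∈ matchFuel f L′)
matchFuel-step f {L} L≤1+f s p with step L in eq
... | nothing = ⊥-elim (step-complete s eq)
... | just (q₀ , L₀) with step-diamond (step-sound L eq) s
... | same refl refl = ∈-∷
matchFuel-step zero {L} L≤1 s p | just (q₀ , L₀) | join s₀ _ =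
  ⊥-elim (step-length≰0 s₀ (step-length-≤ (step-sound L eq) L≤1))
matchFuel-step (suc f) {L} {q} {L′} L≤2+f s p | just (q₀ , L₀) | join {M} s₀ s′ = begin
  p ∈ q₀ ∷ matchFuel (suc f) L₀             ≈⟨ ∈-∷ ⟩
  (p ≡ q₀ ⊎ p ∈ matchFuel (suc f) L₀)       ≈⟨ ⇔.refl ⊎-⇔ matchFuel-step f L₀≤1+f s₀ p ⟩
  (p ≡ q₀ ⊎ (p ≡ q ⊎ p ∈ matchFuel f M))    ≈⟨ ⊎-exchange ⟩
  (p ≡ q ⊎ (p ≡ q₀ ⊎ p ∈ matchFuel f M))    ≈⟨ ⇔.refl ⊎-⇔ matchFuel-step f L′≤1+f s′ p ⟨
  (p ≡ q ⊎ p ∈ matchFuel (suc f) L′)        ∎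
  where
  open import Relation.Binary.Reasoning.Setoid (⇔.⇔-setoid 0ℓ)
  L₀≤1+f : length L₀ ≤ suc f
  L₀≤1+f = step-length-≤ (step-sound L eq) L≤2+f
  L′≤1+f : length L′ ≤ suc f
  L′≤1+f = step-length-≤ s L≤2+f

matchFuel-terminal : ∀ f {R} → Terminal R → matchFuel f R ≡ []
matchFuel-terminal zero t = refl
matchFuel-terminal (suc f) {R} t with step R in eq
... | nothing = refl
... | just _ = ⊥-elim (t (step-sound R eq))

matchFuel⇔run : ∀ f {L Q R} → length L ≤ f → Run L Q R → Terminal R → ∀ p
              → (p ∈ matchFuel f L) ⇔ (p ∈ Q)
matchFuel⇔run f _ done t p rewrite matchFuel-terminal f t = mk⇔ (λ ()) (λ ())
matchFuel⇔run zero L≤0 (more s _) _ _ = ⊥-elim (step-length≰0 s L≤0)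
matchFuel⇔run (suc f) L≤1+f (more s r) t p =
  ⇔.trans (matchFuel-step f L≤1+f s p)
          (⇔.trans (⇔.refl ⊎-⇔ matchFuel⇔run f (step-length-≤ s L≤1+f) r t p) (⇔.sym ∈-∷))

-- Invariants of runs

letters : Letters → Word
letters = map proj₂

step-count : ∀ b {L q L′} → Step L q L′ → count b (letters L) ≡ suc (count b (letters L′))
step-count b0 (adjacent here) = refl
step-count b1 (adjacent here) = refl
step-count b0 (adjacent (there {x = _ , b0} a)) = cong suc (step-count b0 (adjacent a))
step-count b0 (adjacent (there {x = _ , b1} a)) = step-count b0 (adjacent a)
step-count b1 (adjacent (there {x = _ , b1} a)) = cong suc (step-count b1 (adjacent a))
step-count b1 (adjacent (there {x = _ , b0} a)) = step-count b1 (adjacent a)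
step-count b0 (wraparound {i = i} {C = C} refl) rewrite map-++ proj₂ C [ (i , b0) ] =
  trans (count-++ b0 (letters C) [ b0 ]) (+-comm (count b0 (letters C)) 1)
step-count b1 (wraparound {i = i} {C = C} refl) rewrite map-++ proj₂ C [ (i , b0) ] =
  cong suc (trans (count-++ b1 (letters C) [ b0 ]) (+-identityʳ (count b1 (letters C))))

run-count : ∀ b {L Q R} → Run L Q R → count b (letters L) ≡ count b (letters R) + length Q
run-count b done = sym (+-identityʳ _)
run-count b {L} {_ ∷ Q} {R} (more {L′ = L′} s r) = begin
  count b (letters L)                      ≡⟨ step-count b s ⟩
  suc (count b (letters L′))               ≡⟨ cong suc (run-count b r) ⟩
  suc (count b (letters R) + length Q)     ≡⟨ +-suc (count b (letters R)) (length Q) ⟨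
  count b (letters R) + suc (length Q)     ∎
  where open ≡-Reasoning

step-⊆ : ∀ {L q L′ y} → Step L q L′ → y ∈ L′ → y ∈ L
step-⊆ (adjacent here) y∈L′ = there (there y∈L′)
step-⊆ (adjacent (there a)) (here refl) = here refl
step-⊆ (adjacent (there a)) (there y∈L′) = there (step-⊆ (adjacent a) y∈L′)
step-⊆ (wraparound refl) y∈C = there (∈-++⁺ˡ y∈C)

step-matched : ∀ {L i j L′} → Step L (i , j) L′ → (i , b0) ∈ L × (j , b1) ∈ L
step-matched (adjacent here) = here refl , there (here refl)
step-matched (adjacent (there a)) with step-matched (adjacent a)
... | i∈L , j∈L = there i∈L , there j∈L
step-matched (wraparound {C = C} refl) = there (∈-++⁺ʳ C (here refl)) , here refl

step-cover : ∀ {L i j L′ y} → Step L (i , j) L′ → y ∈ L → y ∈ L′ ⊎ (proj₁ y ≡ i ⊎ proj₁ y ≡ j)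
step-cover (adjacent here) (here refl) = inj₂ (inj₁ refl)
step-cover (adjacent here) (there (here refl)) = inj₂ (inj₂ refl)
step-cover (adjacent here) (there (there y∈L′)) = inj₁ y∈L′
step-cover (adjacent (there a)) (here refl) = inj₁ (here refl)
step-cover (adjacent (there a)) (there y∈L) with step-cover (adjacent a) y∈L
... | inj₁ y∈L′ = inj₁ (there y∈L′)
... | inj₂ y∈q = inj₂ y∈q
step-cover (wraparound refl) (here refl) = inj₂ (inj₂ refl)
step-cover (wraparound {C = C} refl) (there y∈C∷ʳi) with ∈-++⁻ C y∈C∷ʳi
... | inj₁ y∈C = inj₁ y∈C
... | inj₂ (here refl) = inj₂ (inj₁ refl)

Increasing : Letters → Set
Increasing = AllPairs (λ x y → proj₁ x < proj₁ y)

increasing-head≤ : ∀ {x L y} → Increasing (x ∷ L) → y ∈ x ∷ L → proj₁ x ≤ proj₁ y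
increasing-head≤ _ (here refl) = ≤-refl
increasing-head≤ (x< ∷ _) (there y∈L) = <⇒≤ (All.lookup x< y∈L)

increasing-≤last : ∀ L {x y} → Increasing (L ∷ʳ x) → y ∈ L ∷ʳ x → proj₁ y ≤ proj₁ x
increasing-≤last L inc y∈ with ∈-++⁻ L y∈
... | inj₁ y∈L = <⇒≤ (All.lookup (proj₂ (allPairs-∷ʳ⁻ L inc)) y∈L)
... | inj₂ (here refl) = ≤-refl

step-increasing : ∀ {L q L′} → Increasing L → Step L q L′ → Increasing L′
step-increasing (_ ∷ _ ∷ inc) (adjacent here) = inc
step-increasing (x< ∷ inc) (adjacent (there a)) =
  All.tabulate (All.lookup x< ∘ step-⊆ (adjacent a)) ∷ step-increasing inc (adjacent a)
step-increasing (_ ∷ inc) (wraparound {C = C} refl) = proj₁ (allPairs-∷ʳ⁻ C inc)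

step-fresh : ∀ {L i j L′ y} → Increasing L → Step L (i , j) L′ → y ∈ L′
           → proj₁ y ≢ i × proj₁ y ≢ j
step-fresh (i< ∷ j< ∷ _) (adjacent here) y∈L′ =
  (λ where refl → <⇒≢ (All.lookup i< (there y∈L′)) refl) ,
  (λ where refl → <⇒≢ (All.lookup j< y∈L′) refl)
step-fresh (_ ∷ inc) (adjacent (there a)) (there y∈L′) = step-fresh inc (adjacent a) y∈L′
step-fresh (x< ∷ _) (adjacent (there a)) (here refl) with step-matched (adjacent a)
... | i∈L , j∈L = <⇒≢ (All.lookup x< i∈L) , <⇒≢ (All.lookup x< j∈L)
step-fresh (j< ∷ inc) (wraparound {C = C} refl) y∈C =
  <⇒≢ (All.lookup (proj₂ (allPairs-∷ʳ⁻ C inc)) y∈C) ,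
  (λ where refl → <⇒≢ (All.lookup j< (∈-++⁺ˡ y∈C)) refl)

Matched : ℕ → List (ℕ × ℕ) → Set
Matched k Q = Σ ℕ λ j → ((k , j) ∈ Q) ⊎ ((j , k) ∈ Q)

matched-∷ : ∀ {k q Q} → Matched k Q → Matched k (q ∷ Q)
matched-∷ (j , inj₁ kj∈Q) = j , inj₁ (there kj∈Q)
matched-∷ (j , inj₂ jk∈Q) = j , inj₂ (there jk∈Q)

run-⊆ : ∀ {L Q R y} → Run L Q R → y ∈ R → y ∈ L
run-⊆ done y∈R = y∈R
run-⊆ (more s r) y∈R = step-⊆ s (run-⊆ r y∈R)

run-cover : ∀ {L Q R y} → Run L Q R → y ∈ L → y ∈ R ⊎ Matched (proj₁ y) Q
run-cover done y∈L = inj₁ y∈L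
run-cover (more {q = i , j} s r) y∈L with step-cover s y∈L
... | inj₂ (inj₁ refl) = inj₂ (j , inj₁ (here refl))
... | inj₂ (inj₂ refl) = inj₂ (i , inj₂ (here refl))
... | inj₁ y∈L′ with run-cover r y∈L′
...   | inj₁ y∈R = inj₁ y∈R
...   | inj₂ y∈Q = inj₂ (matched-∷ y∈Q)

run-increasing : ∀ {L Q R} → Increasing L → Run L Q R → Increasing R
run-increasing inc done = inc
run-increasing inc (more s r) = run-increasing (step-increasing inc s) r

run-fresh : ∀ {L Q R y} → Increasing L → Run L Q R → y ∈ R → ¬ Matched (proj₁ y) Q
run-fresh inc done y∈R (_ , inj₁ ())
run-fresh inc done y∈R (_ , inj₂ ())
run-fresh inc (more s r) y∈R (_ , inj₁ (here refl)) = proj₁ (step-fresh inc s (run-⊆ r y∈R)) refl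
run-fresh inc (more s r) y∈R (_ , inj₂ (here refl)) = proj₂ (step-fresh inc s (run-⊆ r y∈R)) refl
run-fresh inc (more s r) y∈R (j , inj₁ (there y∈Q)) = run-fresh (step-increasing inc s) r y∈R (j , inj₁ y∈Q)
run-fresh inc (more s r) y∈R (j , inj₂ (there y∈Q)) = run-fresh (step-increasing inc s) r y∈R (j , inj₂ y∈Q)

IsOne IsZero : ℕ × Bit → Set
IsOne  y = proj₂ y ≡ b1
IsZero y = proj₂ y ≡ b0

count-ones : ∀ {R} → All IsOne R → count b1 (letters R) ≡ length R × count b0 (letters R) ≡ 0
count-ones [] = refl , refl
count-ones (refl ∷ ones) with count-ones ones
... | c₁ , c₀ = cong suc c₁ , c₀

count-zeros : ∀ {R} → All IsZero R → count b1 (letters R) ≡ 0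
count-zeros [] = refl
count-zeros (refl ∷ zeros) = count-zeros zeros

ones-then-zeros : ∀ R → (∀ {q R′} → ¬ Adjacent R q R′)
                → Σ Letters λ O → Σ Letters λ Z → R ≡ O ++ Z × All IsOne O × All IsZero Z
ones-then-zeros [] _ = [] , [] , refl , [] , []
ones-then-zeros (x ∷ R) no-adj with ones-then-zeros R (no-adj ∘ there)
ones-then-zeros ((k , b1) ∷ _) no-adj | O , Z , refl , ones , zeros =
  (k , b1) ∷ O , Z , refl , refl ∷ ones , zeros
ones-then-zeros ((k , b0) ∷ _) no-adj | [] , Z , refl , _ , zeros =
  [] , (k , b0) ∷ Z , refl , [] , refl ∷ zeros
ones-then-zeros ((k , b0) ∷ _) no-adj | _ ∷ O , Z , refl , refl ∷ _ , _ = ⊥-elim (no-adj here)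

-- Without adjacent 01 the letters read 1…10…0, and the wrap-around step rules out
-- both blocks being nonempty.
terminal-ones : ∀ R → Terminal R → count b0 (letters R) < count b1 (letters R) → All IsOne R
terminal-ones R terminal c₀<c₁ with ones-then-zeros R (terminal ∘ adjacent)
... | O , Z , refl , ones , zeros with initLast Z
...   | [] rewrite ++-identityʳ O = ones
terminal-ones R terminal c₀<c₁ | [] , _ , refl , _ , zeros | _ ∷ʳ′ _
  with () ← subst (count b0 (letters R) <_) (count-zeros zeros) c₀<c₁
terminal-ones _ terminal c₀<c₁ | (j , _) ∷ O , _ , refl , refl ∷ _ , zeros | Z ∷ʳ′ (i , _)
  with refl ← proj₂ (∷ʳ⁻ {xs = Z} zeros) = ⊥-elim (terminal (wraparound (cong ((j , b1) ∷_) (sym (++-assoc O Z _)))))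

ones-terminal : ∀ {R} → All IsOne R → Terminal R
ones-terminal ones s with () ← All.lookup ones (proj₁ (step-matched s))

enum : ℕ → Word → Letters
enum s [] = []
enum s (a ∷ w) = (s , a) ∷ enum (suc s) w

-- Stated for an arbitrary g ≗ (s +_) because `applyUpTo g (suc n)` continues with `g ∘ suc`.
zip-applyUpTo : ∀ g s w → (∀ i → g i ≡ s + i) → zip (applyUpTo g (length w)) w ≡ enum s w
zip-applyUpTo g s [] _ = refl
zip-applyUpTo g s (a ∷ w) g≗s+ =
  cong₂ (λ k L → (k , a) ∷ L) (trans (g≗s+ 0) (+-identityʳ s))
        (zip-applyUpTo (g ∘ suc) (suc s) w (λ i → trans (g≗s+ (suc i)) (+-suc s i)))

pairs-enum : ∀ w → pairs w ≡ matchFuel (length w) (enum 0 w)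
pairs-enum w = cong (matchFuel (length w)) (zip-applyUpTo (λ i → i) 0 w (λ _ → refl))

letters-enum : ∀ s w → letters (enum s w) ≡ w
letters-enum s [] = refl
letters-enum s (a ∷ w) = cong (a ∷_) (letters-enum (suc s) w)

length-enum : ∀ s w → length (enum s w) ≡ length w
length-enum s [] = refl
length-enum s (a ∷ w) = cong suc (length-enum (suc s) w)

enum-> : ∀ s w {y} → y ∈ enum (suc s) w → s < proj₁ y
enum-> s (a ∷ w) (here refl) = ≤-refl
enum-> s (a ∷ w) (there y∈) = <⇒≤ (enum-> (suc s) w y∈)

enum-increasing : ∀ s w → Increasing (enum s w)
enum-increasing s [] = []
enum-increasing s (a ∷ w) = All.tabulate (enum-> s w) ∷ enum-increasing (suc s) w

∈-enum⁺ : ∀ s w d {b} → at w d ≡ just b → (s + d , b) ∈ enum s w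
∈-enum⁺ s (a ∷ w) zero refl = here (cong (_, a) (+-identityʳ s))
∈-enum⁺ s (a ∷ w) (suc d) {b} at≡b =
  there (subst (λ k → (k , b) ∈ enum (suc s) w) (sym (+-suc s d)) (∈-enum⁺ (suc s) w d at≡b))

∈-enum⁻ : ∀ s w {k b} → (k , b) ∈ enum s w → Σ ℕ λ d → k ≡ s + d × at w d ≡ just b
∈-enum⁻ s (a ∷ w) (here refl) = 0 , sym (+-identityʳ s) , refl
∈-enum⁻ s (a ∷ w) (there kb∈) with ∈-enum⁻ (suc s) w kb∈
... | d , refl , at≡b = suc d , sym (+-suc s d) , at≡b

at-length : ∀ w d {b} → at w d ≡ just b → d < length w
at-length (a ∷ w) zero    _    = s≤s z≤n
at-length (a ∷ w) (suc d) at≡b = s≤s (at-length w d at≡b)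

pairs-run : ∀ v → Σ Letters λ R → Run (enum 0 v) (pairs v) R × Terminal R
pairs-run v rewrite pairs-enum v = matchFuel-terminal-run (length v) (enum 0 v) (≤-reflexive (length-enum 0 v))

pairs⇔run : ∀ v {Q R} → Run (enum 0 v) Q R → Terminal R → ∀ p → (p ∈ pairs v) ⇔ (p ∈ Q)
pairs⇔run v run terminal p rewrite pairs-enum v =
  matchFuel⇔run (length v) (≤-reflexive (length-enum 0 v)) run terminal p

count-run : ∀ b v {Q R} → Run (enum 0 v) Q R → count b v ≡ count b (letters R) + length Q
count-run b v run = trans (cong (count b) (sym (letters-enum 0 v))) (run-count b run)

unmatched-letters : ∀ v → count b0 v < count b1 v
  → Σ Letters λ R → Run (enum 0 v) (pairs v) R × All IsOne R × length R + count b0 v ≡ count b1 v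
unmatched-letters v c₀<c₁ with pairs-run v
... | R , run , terminal = R , run , ones , (begin
  length R + count b0 v                       ≡⟨ cong (length R +_) (count-run b0 v run) ⟩
  length R + (count b0 (letters R) + #pairs)  ≡⟨ cong (λ n → length R + (n + #pairs)) (proj₂ (count-ones ones)) ⟩
  length R + #pairs                           ≡⟨ cong (_+ #pairs) (proj₁ (count-ones ones)) ⟨
  count b1 (letters R) + #pairs               ≡⟨ count-run b1 v run ⟨
  count b1 v                                  ∎)
  where
  open ≡-Reasoning
  #pairs : ℕ
  #pairs = length (pairs v)
  ones : All IsOne R
  ones = terminal-ones R terminal
           (+-cancelʳ-< #pairs _ _ (subst₂ _<_ (count-run b0 v run) (count-run b1 v run) c₀<c₁))

unmatched⇒∈ : ∀ v {R k} → Run (enum 0 v) (pairs v) R → Unmatched v k → (k , b1) ∈ R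
unmatched⇒∈ v {k = k} run (_ , at≡b1 , unmatched) with run-cover run (∈-enum⁺ 0 v k at≡b1)
... | inj₁ k∈R = k∈R
... | inj₂ matched = ⊥-elim (unmatched matched)

∈⇒unmatched : ∀ v {R k b} → Run (enum 0 v) (pairs v) R → All IsOne R → (k , b) ∈ R → Unmatched v k
∈⇒unmatched v run ones kb∈R with ∈-enum⁻ 0 v (run-⊆ run kb∈R) | All.lookup ones kb∈R
... | d , refl , at≡b1 | refl = at-length v d at≡b1 , at≡b1 , run-fresh (enum-increasing 0 v) run kb∈R

unmatched-leftmost-rightmost : ∀ w {R r l} → Run (enum 0 w) (pairs w) R → All IsOne R → 2 ≤ length R
  → RightmostUnmatched w r → LeftmostUnmatched w l → Σ Letters λ C → R ≡ (l , b1) ∷ C ∷ʳ (r , b1)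
unmatched-leftmost-rightmost w {R} {r} {l} run ones 2≤ (uᵣ , r-max) (uₗ , l-min) with first-middle-last {L = R} 2≤
... | (a , _) , C , (c , _) , refl with ones
... | refl ∷ ones′ with refl ← proj₂ (∷ʳ⁻ {xs = C} ones′) = C , cong₂ (λ l r → (l , b1) ∷ C ∷ʳ (r , b1)) a≡l c≡r
  where
  inc : Increasing ((a , b1) ∷ C ∷ʳ (c , b1))
  inc = run-increasing (enum-increasing 0 w) run
  a≡l : a ≡ l
  a≡l = ≤-antisym (increasing-head≤ inc (unmatched⇒∈ w run uₗ)) (l-min a (∈⇒unmatched w run ones (here refl)))
  c≡r : c ≡ r
  c≡r = ≤-antisym (r-max c (∈⇒unmatched w run ones (∈-++⁺ʳ ((a , b1) ∷ C) (here refl))))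
                  (increasing-≤last ((a , b1) ∷ C) inc (unmatched⇒∈ w run uᵣ))

-- Changing one letter

relabel : ℕ → Bit → ℕ × Bit → ℕ × Bit
relabel r b (k , a) with k ≟ r
... | yes _ = k , b
... | no  _ = k , a

relabel-self : ∀ r b a → relabel r b (r , a) ≡ (r , b)
relabel-self r b a with r ≟ r
... | yes _ = refl
... | no r≢r = ⊥-elim (r≢r refl)

relabel-other : ∀ {r k} b a → k ≢ r → relabel r b (k , a) ≡ (k , a)
relabel-other {r} {k} b a k≢r with k ≟ r
... | yes k≡r = ⊥-elim (k≢r k≡r)
... | no  _   = refl

map-relabel-other : ∀ r b {L} → All (λ y → proj₁ y ≢ r) L → map (relabel r b) L ≡ L
map-relabel-other r b [] = refl
map-relabel-other r b (k≢r ∷ L≢r) = cong₂ _∷_ (relabel-other b _ k≢r) (map-relabel-other r b L≢r)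

enum-setAt : ∀ s k b w r → r ≡ s + k → enum s (setAt k b w) ≡ map (relabel r b) (enum s w)
enum-setAt s k b [] r _ = refl
enum-setAt s zero b (a ∷ w) r r≡s+0 rewrite trans r≡s+0 (+-identityʳ s) =
  cong₂ _∷_ (sym (relabel-self s b a))
    (sym (map-relabel-other s b (All.tabulate (λ y∈ → ≢-sym (<⇒≢ (enum-> s w y∈))))))
enum-setAt s (suc k) b (a ∷ w) r r≡s+1+k =
  cong₂ _∷_ (sym (relabel-other b a (<⇒≢ s<r)))
    (enum-setAt (suc s) k b w r (trans r≡s+1+k (+-suc s k)))
  where
  s<r : s < r
  s<r = subst (s <_) (sym r≡s+1+k) (m<m+n s z<s)

adjacent-relabel : ∀ r b {L i j L′} → Adjacent L (i , j) L′ → i ≢ r → j ≢ r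
                 → Adjacent (map (relabel r b) L) (i , j) (map (relabel r b) L′)
adjacent-relabel r b here i≢r j≢r rewrite relabel-other b b0 i≢r | relabel-other b b1 j≢r = here
adjacent-relabel r b (there a) i≢r j≢r = there (adjacent-relabel r b a i≢r j≢r)

step-relabel : ∀ r b {L i j L′} → Step L (i , j) L′ → i ≢ r → j ≢ r
             → Step (map (relabel r b) L) (i , j) (map (relabel r b) L′)
step-relabel r b (adjacent a) i≢r j≢r = adjacent (adjacent-relabel r b a i≢r j≢r)
step-relabel r b (wraparound {C = C} refl) i≢r j≢r =
  wraparound (cong₂ _∷_ (relabel-other b b1 j≢r)
                        (trans (map-++ (relabel r b) C _) (cong (λ y → map (relabel r b) C ∷ʳ y) (relabel-other b b0 i≢r))))

run-relabel : ∀ r b {L Q R} → Run L Q R → ¬ Matched r Q → Run (map (relabel r b) L) Q (map (relabel r b) R)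
run-relabel r b done _ = done
run-relabel r b (more {q = i , j} s run) r-unmatched =
  more (step-relabel r b s (λ where refl → r-unmatched (j , inj₁ (here refl)))
                           (λ where refl → r-unmatched (i , inj₂ (here refl))))
       (run-relabel r b run (r-unmatched ∘ matched-∷))

pairs-zeroing-last-unmatched : ∀ w {a C c} → Run (enum 0 w) (pairs w) ((a , b1) ∷ C ∷ʳ (c , b1)) → All IsOne C
  → ∀ p → (p ∈ pairs (setAt c b0 w)) ⇔ (p ∈ pairs w ⊎ p ≡ (c , a))
pairs-zeroing-last-unmatched w {a} {C} {c} run ones p =
  ⇔.trans (pairs⇔run (setAt c b0 w) run′ (ones-terminal ones) p) (∈-∷ʳ (pairs w))
  where
  below-c : All (λ y → proj₁ y ≢ c) ((a , b1) ∷ C)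
  below-c = All.map <⇒≢ (proj₂ (allPairs-∷ʳ⁻ ((a , b1) ∷ C) (run-increasing (enum-increasing 0 w) run)))
  relabelled : map (relabel c b0) ((a , b1) ∷ C ∷ʳ (c , b1)) ≡ (a , b1) ∷ C ∷ʳ (c , b0)
  relabelled = trans (map-++ (relabel c b0) ((a , b1) ∷ C) _)
                     (cong₂ _∷ʳ_ (map-relabel-other c b0 below-c) (relabel-self c b0 b1))
  c-unmatched : ¬ Matched c (pairs w)
  c-unmatched = run-fresh (enum-increasing 0 w) run (∈-++⁺ʳ ((a , b1) ∷ C) (here refl))
  run′ : Run (enum 0 (setAt c b0 w)) (pairs w ∷ʳ (c , a)) C
  run′ = run-++ (subst₂ (λ L R → Run L (pairs w) R) (sym (enum-setAt 0 c b0 w c refl)) relabelled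
                        (run-relabel c b0 run c-unmatched))
                (more (wraparound refl) done)

pairs-zeroing-rightmost-unmatched : ∀ w {R r l} → Run (enum 0 w) (pairs w) R → All IsOne R → 2 ≤ length R
  → RightmostUnmatched w r → LeftmostUnmatched w l
  → ∀ p → (p ∈ pairs (setAt r b0 w)) ⇔ (p ∈ pairs w ⊎ p ≡ (r , l))
pairs-zeroing-rightmost-unmatched w run ones 2≤ rightmost leftmost p
  with C , refl ← unmatched-leftmost-rightmost w run ones 2≤ rightmost leftmost
  = pairs-zeroing-last-unmatched w run (proj₁ (∷ʳ⁻ {xs = C} (All.tail ones))) p

mainTheorem3 : (x w : Word) → count b0 x < count b1 x
    → (Σ ℕ λ i → Σ ℕ λ j → ¬ (i ≡ j) × Unmatched x i × Unmatched x j)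
    → IsLyndonRearrangement x w
    → (r l : ℕ) → RightmostUnmatched w r → LeftmostUnmatched w l
    → (p : ℕ × ℕ) → (p ∈ pairs (setAt r b0 w)) ⇔ ((p ∈ pairs w) ⊎ (p ≡ (r , l)))
mainTheorem3 x w c₀<c₁ (i , j , i≢j , uᵢ , uⱼ) ((k , refl) , _) r l rightmost leftmost
  with Rx , run-x , _ , count-x ← unmatched-letters x c₀<c₁
     | Rw , run-w , ones-w , count-w ← unmatched-letters (rotate k x)
                                         (subst₂ _<_ (sym (count-rotate b0 k x)) (sym (count-rotate b1 k x)) c₀<c₁)
  = pairs-zeroing-rightmost-unmatched (rotate k x) run-w ones-w (subst (2 ≤_) (sym same-length) two-unmatched) rightmost leftmost
  where
  two-unmatched : 2 ≤ length Rx
  two-unmatched = two≤length (unmatched⇒∈ x run-x uᵢ) (unmatched⇒∈ x run-x uⱼ) (i≢j ∘ cong proj₁)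
  same-length : length Rw ≡ length Rx
  same-length = +-cancelʳ-≡ (count b0 x) (length Rw) (length Rx) (begin
    length Rw + count b0 x             ≡⟨ cong (length Rw +_) (count-rotate b0 k x) ⟨
    length Rw + count b0 (rotate k x)  ≡⟨ trans count-w (count-rotate b1 k x) ⟩
    count b1 x                         ≡⟨ count-x ⟨
    length Rx + count b0 x             ∎)
    where open ≡-Reasoning
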